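{- The following grids are perfect: (a) $(4,4,c)$ for every integer $c\ge 4$ with $c\equiv 1\pmod 3$; (b) $(4,7,c)$ for every integer $c\ge 4$ with $c\equiv 1\pmod 3$. Here a grid $(a,b,c)$ is perfect if some subset of its vertices of size exactly $(ab+ac+bc)/3$ percolates under the $3$-neighbour bootstrap percolation process.
   Context: For positive integers $a,b,c$, the grid $(a,b,c)$ is the graph $P_a\Box P_b\Box P_c$ with vertex set $[a]\times[b]\times[c]$, two vertices being adjacent iff they differ by exactly $1$ in exactly one coordinate and agree in the others. In the $3$-neighbour bootstrap percolation process, starting from $A_0\subseteq V(G)$, one sets $A_t = A_{t-1}\cup\{v : |N(v)\cap A_{t-1}|\ge 3\}$ for $t\ge1$; $A_0$ percolates if $\bigcup_t A_t = V(G)$. -}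

module Defs where

open import Data.Nat using (ℕ; zero; suc; _+_; _*_; _≥_; _%_)
open import Data.Fin using (Fin; toℕ)
open import Data.Product using (_×_; _,_; ∃; Σ-syntax; ∃-syntax)
open import Data.Sum using (_⊎_)
open import Data.List using (List; length)
open import Data.List.Membership.Propositional using (_∈_)
open import Data.List.Relation.Unary.Unique.Propositional using (Unique)
open import Relation.Binary.PropositionalEquality using (_≡_; _≢_)

-- vertices of the grid (a,b,c) = P_a □ P_b □ P_c, coordinates 0-based
Vertex : ℕ → ℕ → ℕ → Set
Vertex a b c = Fin a × Fin b × Fin c

Diff1 : ℕ → ℕ → Set
Diff1 x y = suc x ≡ y ⊎ suc y ≡ x

Adj : ∀ {a b c} → Vertex a b c → Vertex a b c → Set
Adj (x₁ , y₁ , z₁) (x₂ , y₂ , z₂) =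
  (Diff1 (toℕ x₁) (toℕ x₂) × y₁ ≡ y₂ × z₁ ≡ z₂)
  ⊎ (x₁ ≡ x₂ × Diff1 (toℕ y₁) (toℕ y₂) × z₁ ≡ z₂)
  ⊎ (x₁ ≡ x₂ × y₁ ≡ y₂ × Diff1 (toℕ z₁) (toℕ z₂))

VSet : ℕ → ℕ → ℕ → Set₁
VSet a b c = Vertex a b c → Set

ThreeNbrs : ∀ {a b c} → VSet a b c → Vertex a b c → Set
ThreeNbrs {a} {b} {c} A v =
  ∃[ u₁ ] ∃[ u₂ ] ∃[ u₃ ]
    (u₁ ≢ u₂ × u₁ ≢ u₃ × u₂ ≢ u₃ ×
     Adj v u₁ × Adj v u₂ × Adj v u₃ ×
     A u₁ × A u₂ × A u₃)

Step : ∀ {a b c} → VSet a b c → ℕ → VSet a b c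
Step A zero    v = A v
Step A (suc t) v = Step A t v ⊎ ThreeNbrs (Step A t) v

Percolates : ∀ {a b c} → VSet a b c → Set
Percolates {a} {b} {c} A = (v : Vertex a b c) → ∃[ t ] Step A t v

-- grid (a,b,c) is perfect: some set of exactly (ab+ac+bc)/3 vertices percolates.
-- The finite vertex set is given as a duplicate-free list; size k with 3k = ab+ac+bc.
Perfect : ℕ → ℕ → ℕ → Set
Perfect a b c =
  Σ[ S ∈ List (Vertex a b c) ]
    (Unique S × 3 * length S ≡ a * b + a * c + b * c ×
     Percolates {a} {b} {c} (λ v → v ∈ S))

{-# OPTIONS --safe #-}
-- A grid (a, b, 4 + 3k) is cut into horizontal layers of twelve types: four `short` layers when
-- k = 0, and otherwise three `base` layers, k − 1 periods of three `period` layers, and the top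
-- period₀ period₁ cap₀ cap₁. For each layer type a table marks the initially infected vertices
-- and names, for every other vertex, three neighbours that are infected strictly earlier in a
-- ranking: an upward sweep whose clock advances by a constant M per period, followed by a
-- downward sweep whose clock does the same. Because the clock shift between adjacent layers
-- depends only on their types, finitely many checks (each layer type, and each of the eleven
-- pairs of types that can be adjacent) certify the ranking for every k at once, and induction on
-- the rank shows that the marked vertices percolate. Their number is additive over the layers and
-- comes to exactly (ab + ac + bc)/3.

module Submission where

open import Defs
open import Data.Nat using (ℕ; _≥_; _%_)
open import Data.Product using (_×_)
open import Relation.Binary.PropositionalEquality using (_≡_)

open import Data.Bool using (Bool; true; false; T)
open import Data.Empty using (⊥; ⊥-elim)
open import Data.Fin using (Fin; toℕ; fromℕ<)
open import Data.Fin.Properties using (toℕ-fromℕ<; toℕ-injective; toℕ<n)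
open import Data.List using (List; []; _∷_; _++_; length; map; filter; tabulate; allFin; cartesianProduct; cartesianProductWith)
open import Data.List.Properties using (length-++; filter-++; map-tabulate)
open import Data.List.Membership.Propositional using (_∈_)
open import Data.List.Relation.Unary.Unique.Propositional using (Unique)
open import Data.List.Membership.Propositional.Properties using (∈-filter⁺; ∈-allFin; ∈-cartesianProduct⁺; ∈-cartesianProductWith⁺)
import Data.List.Relation.Unary.Unique.Propositional.Properties as Unique
open import Data.Nat using (zero; suc; _+_; _*_; _∸_; _<_; _≤_; _≤′_; ≤′-refl; ≤′-step; _⊔_; _<?_; s≤s; allUpTo?)
open import Data.Nat.Properties
open import Data.Nat.DivMod using (_/_; m≡m%n+[m/n]*n)
open import Data.Nat.Induction using (<-wellFounded)
open import Data.Nat.ListAction using (sum)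
open import Data.Nat.Tactic.RingSolver using (solve-∀)
open import Data.Product using (_,_; proj₁; proj₂; ∃-syntax)
open import Data.Product.Properties using (≡-dec)
open import Data.Sum using (_⊎_; inj₁; inj₂)
import Data.Sum as Sum
open import Data.Unit using (⊤; tt)
open import Function using (_∘_; id)
open import Induction.WellFounded using (WellFounded; Acc; acc)
open import Relation.Binary using (DecidableEquality)
open import Relation.Binary.PropositionalEquality using (_≢_; module ≡-Reasoning; refl; sym; trans; cong; cong₂; subst; subst₂)
open import Relation.Nullary using (Dec; does; yes; no; ¬_)
open import Relation.Nullary.Decidable using (map′; from-yes; T?; ¬?; _×-dec_; _⊎-dec_; _→-dec_)
open import Relation.Unary using (Decidable)

module _ {a b c : ℕ} (A : VSet a b c) where

  Step-mono : ∀ {s t} → s ≤ t → ∀ {v} → Step A s v → Step A t v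
  Step-mono s≤t = go (≤⇒≤′ s≤t)
    where
    go : ∀ {s t} → s ≤′ t → ∀ {v} → Step A s v → Step A t v
    go ≤′-refl       h = h
    go (≤′-step s≤t) h = inj₁ (go s≤t h)

  ThreeNbrs-map : ∀ {P Q : VSet a b c} {v} → (∀ {u} → P u → Q u) → ThreeNbrs P v → ThreeNbrs Q v
  ThreeNbrs-map f (u₁ , u₂ , u₃ , ≢₁₂ , ≢₁₃ , ≢₂₃ , adj₁ , adj₂ , adj₃ , p₁ , p₂ , p₃) =
    u₁ , u₂ , u₃ , ≢₁₂ , ≢₁₃ , ≢₂₃ , adj₁ , adj₂ , adj₃ , f p₁ , f p₂ , f p₃

  ThreeNbrs-eventually : ∀ {v} → ThreeNbrs (λ u → ∃[ t ] Step A t u) v → ∃[ t ] ThreeNbrs (Step A t) v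
  ThreeNbrs-eventually (u₁ , u₂ , u₃ , ≢₁₂ , ≢₁₃ , ≢₂₃ , adj₁ , adj₂ , adj₃ , (t₁ , s₁) , (t₂ , s₂) , (t₃ , s₃)) =
    t₁ ⊔ (t₂ ⊔ t₃) , u₁ , u₂ , u₃ , ≢₁₂ , ≢₁₃ , ≢₂₃ , adj₁ , adj₂ , adj₃ ,
    Step-mono (m≤m⊔n t₁ _) s₁ ,
    Step-mono (≤-trans (m≤m⊔n t₂ t₃) (m≤n⊔m t₁ _)) s₂ ,
    Step-mono (≤-trans (m≤n⊔m t₂ t₃) (m≤n⊔m t₁ _)) s₃

  percolates-by-rank : ∀ {W : Set} {_≺_ : W → W → Set} → WellFounded _≺_ → (rank : Vertex a b c → W) →
                       (∀ v → A v ⊎ ThreeNbrs (λ u → rank u ≺ rank v) v) → Percolates A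
  percolates-by-rank {_≺_ = _≺_} wf rank ranked v = eventually v (wf (rank v))
    where
    eventually : ∀ v → Acc _≺_ (rank v) → ∃[ t ] Step A t v
    eventually v (acc below) with ranked v
    ... | inj₁ v∈A = 0 , v∈A
    ... | inj₂ nbrs with ThreeNbrs-eventually (ThreeNbrs-map (λ {u} u≺v → eventually u (below u≺v)) nbrs)
    ...   | t , nbrs′ = suc t , inj₂ nbrs′

data Shift : Set where
  stay next prev : Shift

_≟ˢ_ : DecidableEquality Shift
stay ≟ˢ stay = yes refl
stay ≟ˢ next = no λ ()
stay ≟ˢ prev = no λ ()
next ≟ˢ stay = no λ ()
next ≟ˢ next = yes refl
next ≟ˢ prev = no λ ()
prev ≟ˢ stay = no λ ()
prev ≟ˢ next = no λ ()
prev ≟ˢ prev = yes refl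

Moves : Shift → ℕ → ℕ → Set
Moves stay p q = p ≡ q
Moves next p q = suc p ≡ q
Moves prev p q = p ≡ suc q

Moves-unique : ∀ {s s′ p q} → Moves s p q → Moves s′ p q → s ≡ s′
Moves-unique {stay} {stay} _    _    = refl
Moves-unique {stay} {next} refl e    = ⊥-elim (1+n≢n e)
Moves-unique {stay} {prev} refl e    = ⊥-elim (1+n≢n (sym e))
Moves-unique {next} {stay} e    refl = ⊥-elim (1+n≢n e)
Moves-unique {next} {next} _    _    = refl
Moves-unique {next} {prev} refl e    = ⊥-elim (<-irrefl e (m<n⇒m<1+n (n<1+n _)))
Moves-unique {prev} {stay} e    refl = ⊥-elim (1+n≢n (sym e))
Moves-unique {prev} {next} e    refl = ⊥-elim (<-irrefl e (m<n⇒m<1+n (n<1+n _)))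
Moves-unique {prev} {prev} _    _    = refl

data Dir : Set where
  x⁻ x⁺ y⁻ y⁺ z⁻ z⁺ : Dir

shifts : Dir → Shift × Shift × Shift
shifts x⁻ = prev , stay , stay
shifts x⁺ = next , stay , stay
shifts y⁻ = stay , prev , stay
shifts y⁺ = stay , next , stay
shifts z⁻ = stay , stay , prev
shifts z⁺ = stay , stay , next

unshift : Shift × Shift × Shift → Dir
unshift (prev , _    , _   ) = x⁻
unshift (next , _    , _   ) = x⁺
unshift (stay , prev , _   ) = y⁻
unshift (stay , next , _   ) = y⁺
unshift (stay , stay , prev) = z⁻
unshift (stay , stay , _   ) = z⁺

unshift-shifts : ∀ d → unshift (shifts d) ≡ d
unshift-shifts x⁻ = refl
unshift-shifts x⁺ = refl
unshift-shifts y⁻ = refl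
unshift-shifts y⁺ = refl
unshift-shifts z⁻ = refl
unshift-shifts z⁺ = refl

shifts-injective : ∀ {d d′} → shifts d ≡ shifts d′ → d ≡ d′
shifts-injective {d} {d′} e = trans (sym (unshift-shifts d)) (trans (cong unshift e) (unshift-shifts d′))

_≟ᵈ_ : DecidableEquality Dir
d ≟ᵈ d′ = map′ shifts-injective (cong shifts) (≡-dec _≟ˢ_ (≡-dec _≟ˢ_ _≟ˢ_) (shifts d) (shifts d′))

Distinct : Dir → Dir → Dir → Set
Distinct d₁ d₂ d₃ = d₁ ≢ d₂ × d₁ ≢ d₃ × d₂ ≢ d₃

Pos : Set
Pos = ℕ × ℕ × ℕ

MovesBy : Shift × Shift × Shift → Pos → Pos → Set
MovesBy (s , t , u) (x , y , z) (x′ , y′ , z′) = Moves s x x′ × Moves t y y′ × Moves u z z′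

Moved : Dir → Pos → Pos → Set
Moved d = MovesBy (shifts d)

Moved-unique : ∀ {d d′ p q} → Moved d p q → Moved d′ p q → d ≡ d′
Moved-unique (mx , my , mz) (mx′ , my′ , mz′) =
  shifts-injective (cong₂ _,_ (Moves-unique mx mx′) (cong₂ _,_ (Moves-unique my my′) (Moves-unique mz mz′)))

plane : (a b : ℕ) → List (Fin a × Fin b)
plane a b = cartesianProduct (allFin a) (allFin b)

module Grid (a b c : ℕ) where

  InBox : Pos → Set
  InBox (x , y , z) = x < a × y < b × z < c

  pos : Vertex a b c → Pos
  pos (x , y , z) = toℕ x , toℕ y , toℕ z

  pos-inBox : ∀ v → InBox (pos v)
  pos-inBox (x , y , z) = toℕ<n x , toℕ<n y , toℕ<n z

  vertexAt : ∀ {p} → InBox p → Vertex a b c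
  vertexAt (x<a , y<b , z<c) = fromℕ< x<a , fromℕ< y<b , fromℕ< z<c

  pos-vertexAt : ∀ {p} (p∈box : InBox p) → pos (vertexAt p∈box) ≡ p
  pos-vertexAt (x<a , y<b , z<c) =
    cong₂ _,_ (toℕ-fromℕ< x<a) (cong₂ _,_ (toℕ-fromℕ< y<b) (toℕ-fromℕ< z<c))

  Moved⇒Adj : ∀ d {v u : Vertex a b c} → Moved d (pos v) (pos u) → Adj v u
  Moved⇒Adj x⁻ (mx , my , mz) = inj₁ (inj₂ (sym mx) , toℕ-injective my , toℕ-injective mz)
  Moved⇒Adj x⁺ (mx , my , mz) = inj₁ (inj₁ mx , toℕ-injective my , toℕ-injective mz)
  Moved⇒Adj y⁻ (mx , my , mz) = inj₂ (inj₁ (toℕ-injective mx , inj₂ (sym my) , toℕ-injective mz))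
  Moved⇒Adj y⁺ (mx , my , mz) = inj₂ (inj₁ (toℕ-injective mx , inj₁ my , toℕ-injective mz))
  Moved⇒Adj z⁻ (mx , my , mz) = inj₂ (inj₂ (toℕ-injective mx , toℕ-injective my , inj₂ (sym mz)))
  Moved⇒Adj z⁺ (mx , my , mz) = inj₂ (inj₂ (toℕ-injective mx , toℕ-injective my , inj₁ mz))

  Moved-distinct : ∀ {d d′} {v u u′ : Vertex a b c} → d ≢ d′ →
                   Moved d (pos v) (pos u) → Moved d′ (pos v) (pos u′) → u ≢ u′
  Moved-distinct d≢d′ m m′ refl = d≢d′ (Moved-unique m m′)

  Reaches : (Pos → Set) → Dir → Pos → Set
  Reaches P d p = ∃[ q ] Moved d p q × InBox q × P q

  ThreeMoves : (Pos → Set) → Pos → Set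
  ThreeMoves P p = ∃[ d₁ ] ∃[ d₂ ] ∃[ d₃ ] Distinct d₁ d₂ d₃ × Reaches P d₁ p × Reaches P d₂ p × Reaches P d₃ p

  neighbour : ∀ {P} d v → Reaches P d (pos v) → ∃[ u ] Moved d (pos v) (pos u) × P (pos u)
  neighbour {P} d v (q , m , q∈box , Pq) =
    vertexAt q∈box , subst (Moved d (pos v)) eq m , subst P eq Pq
    where eq = sym (pos-vertexAt q∈box)

  threeNbrs-from-moves : ∀ {P} v → ThreeMoves P (pos v) → ThreeNbrs (P ∘ pos) v
  threeNbrs-from-moves v (d₁ , d₂ , d₃ , (d₁≢d₂ , d₁≢d₃ , d₂≢d₃) , r₁ , r₂ , r₃)
    with neighbour d₁ v r₁ | neighbour d₂ v r₂ | neighbour d₃ v r₃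
  ... | u₁ , m₁ , p₁ | u₂ , m₂ , p₂ | u₃ , m₃ , p₃ =
    u₁ , u₂ , u₃ ,
    Moved-distinct d₁≢d₂ m₁ m₂ , Moved-distinct d₁≢d₃ m₁ m₃ , Moved-distinct d₂≢d₃ m₂ m₃ ,
    Moved⇒Adj d₁ m₁ , Moved⇒Adj d₂ m₂ , Moved⇒Adj d₃ m₃ , p₁ , p₂ , p₃

  inLayer : Fin c → Fin a × Fin b → Vertex a b c
  inLayer z (x , y) = x , y , z

  vertices : List (Vertex a b c)
  vertices = cartesianProductWith inLayer (allFin c) (plane a b)

  ∈-vertices : ∀ v → v ∈ vertices
  ∈-vertices (x , y , z) =
    ∈-cartesianProductWith⁺ inLayer (∈-allFin z) (∈-cartesianProduct⁺ (∈-allFin x) (∈-allFin y))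

  vertices-unique : Unique vertices
  vertices-unique =
    Unique.cartesianProductWith⁺ inLayer (λ { refl → refl , refl })
      (Unique.allFin⁺ c) (Unique.cartesianProduct⁺ (Unique.allFin⁺ a) (Unique.allFin⁺ b))

data Rank : Set where
  early late : ℕ → Rank

data _≺_ : Rank → Rank → Set where
  early<early : ∀ {m n} → m < n → early m ≺ early n
  early<late  : ∀ {m n} → early m ≺ late n
  late<late   : ∀ {m n} → m < n → late m ≺ late n

≺-wellFounded : WellFounded _≺_
≺-wellFounded (early n) = early-acc (<-wellFounded n)
  where
  early-acc : ∀ {n} → Acc _<_ n → Acc _≺_ (early n)
  early-acc (acc rs) = acc λ { (early<early m<n) → early-acc (rs m<n) }
≺-wellFounded (late n) = late-acc (<-wellFounded n)
  where
  late-acc : ∀ {n} → Acc _<_ n → Acc _≺_ (late n)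
  late-acc (acc rs) = acc λ { early<late → ≺-wellFounded _ ; (late<late m<n) → late-acc (rs m<n) }

-- Times are read against the clock (o , r) of a layer: `rising t` is t rounds after the upward
-- sweep reached the layer, `falling t` is t rounds after the downward sweep reached it.
data Time : Set where
  fixed rising falling : ℕ → Time

rank : Time → ℕ × ℕ → Rank
rank (fixed t)   _       = early t
rank (rising t)  (o , _) = early (t + o)
rank (falling t) (_ , r) = late (t + r)

_▹_ : ℕ × ℕ → ℕ × ℕ → ℕ × ℕ
(p , p′) ▹ (o , r) = p + o , p′ + r

Precedes : ℕ × ℕ → Time → ℕ × ℕ → Time → Set
Precedes _       (fixed t)   _       (fixed t′)   = t < t′
Precedes _       (fixed t)   (q , _) (rising t′)  = t < t′ + q
Precedes _       (fixed _)   _       (falling _)  = ⊤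
Precedes _       (rising _)  _       (fixed _)    = ⊥
Precedes (p , _) (rising t)  (q , _) (rising t′)  = t + p < t′ + q
Precedes _       (rising _)  _       (falling _)  = ⊤
Precedes _       (falling _) _       (fixed _)    = ⊥
Precedes _       (falling _) _       (rising _)   = ⊥
Precedes (_ , p) (falling t) (_ , q) (falling t′) = t + p < t′ + q

+-shift-< : ∀ {t p t′ q} o → t + p < t′ + q → t + (p + o) < t′ + (q + o)
+-shift-< {t} {p} {t′} {q} o lt = subst₂ _<_ (+-assoc t p o) (+-assoc t′ q o) (+-monoˡ-< o lt)

precedes-sound : ∀ π τ π′ τ′ → Precedes π τ π′ τ′ → ∀ ω → rank τ (π ▹ ω) ≺ rank τ′ (π′ ▹ ω)
precedes-sound _       (fixed t)   _       (fixed t′)   t<t′ _ = early<early t<t′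
precedes-sound _       (fixed t)   (q , _) (rising t′)  t<t′+q (o , _) =
  early<early (≤-trans t<t′+q (+-monoʳ-≤ t′ (m≤m+n q o)))
precedes-sound _       (fixed _)   _       (falling _)  _ _ = early<late
precedes-sound (p , _) (rising t)  (q , _) (rising t′)  lt (o , _) = early<early (+-shift-< {t} {p} {t′} {q} o lt)
precedes-sound _       (rising _)  _       (falling _)  _ _ = early<late
precedes-sound (_ , p) (falling t) (_ , q) (falling t′) lt (_ , r) =
  late<late (+-shift-< {t} {p} {t′} {q} r lt)

precedes? : ∀ π τ π′ τ′ → Dec (Precedes π τ π′ τ′)
precedes? _       (fixed t)   _       (fixed t′)   = t <? t′
precedes? _       (fixed t)   (q , _) (rising t′)  = t <? t′ + q
precedes? _       (fixed _)   _       (falling _)  = yes tt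
precedes? _       (rising _)  _       (fixed _)    = no λ ()
precedes? (p , _) (rising t)  (q , _) (rising t′)  = t + p <? t′ + q
precedes? _       (rising _)  _       (falling _)  = yes tt
precedes? _       (falling _) _       (fixed _)    = no λ ()
precedes? _       (falling _) _       (rising _)   = no λ ()
precedes? (_ , p) (falling t) (_ , q) (falling t′) = t + p <? t′ + q

_⊏_ : Time → Time → Set
τ ⊏ τ′ = Precedes (0 , 0) τ (0 , 0) τ′

length-filter-map : ∀ {A B : Set} {P : B → Set} (P? : Decidable P) (f : A → B) xs →
                    length (filter P? (map f xs)) ≡ length (filter (P? ∘ f) xs)
length-filter-map P? f []       = refl
length-filter-map P? f (x ∷ xs) with does (P? (f x))
... | true  = cong suc (length-filter-map P? f xs)
... | false = length-filter-map P? f xs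

length-filter-cartesianProductWith :
  ∀ {A B C : Set} {P : C → Set} (P? : Decidable P) (f : A → B → C) xs ys →
  length (filter P? (cartesianProductWith f xs ys)) ≡ sum (map (λ x → length (filter (P? ∘ f x) ys)) xs)
length-filter-cartesianProductWith P? f []       ys = refl
length-filter-cartesianProductWith P? f (x ∷ xs) ys = begin
  length (filter P? (map (f x) ys ++ cartesianProductWith f xs ys))
    ≡⟨ cong length (filter-++ P? (map (f x) ys) _) ⟩
  length (filter P? (map (f x) ys) ++ filter P? (cartesianProductWith f xs ys))
    ≡⟨ length-++ (filter P? (map (f x) ys)) ⟩
  length (filter P? (map (f x) ys)) + length (filter P? (cartesianProductWith f xs ys))
    ≡⟨ cong₂ _+_ (length-filter-map P? (f x) ys) (length-filter-cartesianProductWith P? f xs ys) ⟩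
  length (filter (P? ∘ f x) ys) + sum (map (λ x → length (filter (P? ∘ f x) ys)) xs) ∎
  where open ≡-Reasoning

data Entry : Set where
  seed   : Entry
  _from_ : Time → Dir × Dir × Dir → Entry

infix 2 _from_

timeOf : Entry → Time
timeOf seed       = fixed 0
timeOf (τ from _) = τ

seed? : (e : Entry) → Dec (e ≡ seed)
seed? seed       = yes refl
seed? (_ from _) = no λ ()

Needs : Dir → Entry → Set
Needs d seed                  = ⊥
Needs d (_ from d₁ , d₂ , d₃) = d ≡ d₁ ⊎ d ≡ d₂ ⊎ d ≡ d₃

needs? : ∀ d e → Dec (Needs d e)
needs? d seed                  = no λ ()
needs? d (_ from d₁ , d₂ , d₃) = d ≟ᵈ d₁ ⊎-dec d ≟ᵈ d₂ ⊎-dec d ≟ᵈ d₃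

AtPredecessor : (ℕ → Set) → ℕ → Set
AtPredecessor P zero    = ⊥
AtPredecessor P (suc n) = P n

atPredecessor? : ∀ {P} → Decidable P → Decidable (AtPredecessor P)
atPredecessor? P? zero    = no λ ()
atPredecessor? P? (suc n) = P? n

module Layered (a b : ℕ) {L : Set} (entry : L → ℕ → ℕ → Entry) (gap : L → ℕ) where

  time : L → ℕ → ℕ → Time
  time l x y = timeOf (entry l x y)

  -- The vertical directions are accounted for by `Stackable`.
  InPlane : L → ℕ → ℕ → Time → Dir → Set
  InPlane l x y τ x⁻ = AtPredecessor (λ x′ → time l x′ y ⊏ τ) x
  InPlane l x y τ x⁺ = suc x < a × time l (suc x) y ⊏ τ
  InPlane l x y τ y⁻ = AtPredecessor (λ y′ → time l x y′ ⊏ τ) y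
  InPlane l x y τ y⁺ = suc y < b × time l x (suc y) ⊏ τ
  InPlane l x y τ z⁻ = ⊤
  InPlane l x y τ z⁺ = ⊤

  Justified : L → ℕ → ℕ → Entry → Set
  Justified l x y seed                  = ⊤
  Justified l x y (τ from d₁ , d₂ , d₃) =
    Distinct d₁ d₂ d₃ × InPlane l x y τ d₁ × InPlane l x y τ d₂ × InPlane l x y τ d₃

  -- Against a common clock ω, the upper layer runs on (gap hi , 0) ▹ ω and the lower on (0 , gap hi) ▹ ω.
  Stacked : L → L → ℕ → ℕ → Set
  Stacked lo hi x y =
    (Needs z⁻ (entry hi x y) → Precedes (0 , gap hi) (time lo x y) (gap hi , 0) (time hi x y)) ×
    (Needs z⁺ (entry lo x y) → Precedes (gap hi , 0) (time hi x y) (0 , gap hi) (time lo x y))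

  Everywhere : (ℕ → ℕ → Set) → Set
  Everywhere P = ∀ {x} → x < a → ∀ {y} → y < b → P x y

  Planar : L → Set
  Planar l = Everywhere λ x y → Justified l x y (entry l x y)

  Stackable : L → L → Set
  Stackable lo hi = Everywhere (Stacked lo hi)

  Floor Roof : L → Set
  Floor l = Everywhere λ x y → ¬ Needs z⁻ (entry l x y)
  Roof  l = Everywhere λ x y → ¬ Needs z⁺ (entry l x y)

  record Stack (c : ℕ) : Set where
    field
      layer   : ℕ → L
      planar  : ∀ z → Planar (layer z)
      stacked : ∀ z → suc z < c → Stackable (layer z) (layer (suc z))
      floor   : Floor (layer 0)
      roof    : ∀ z → suc z ≡ c → Roof (layer z)

  everywhere? : ∀ {P} → (∀ x y → Dec (P x y)) → Dec (Everywhere P)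
  everywhere? P? = allUpTo? (λ x → allUpTo? (P? x) b) a

  inPlane? : ∀ l x y τ d → Dec (InPlane l x y τ d)
  inPlane? l x y τ x⁻ = atPredecessor? (λ x′ → precedes? _ (time l x′ y) _ τ) x
  inPlane? l x y τ x⁺ = suc x <? a ×-dec precedes? _ (time l (suc x) y) _ τ
  inPlane? l x y τ y⁻ = atPredecessor? (λ y′ → precedes? _ (time l x y′) _ τ) y
  inPlane? l x y τ y⁺ = suc y <? b ×-dec precedes? _ (time l x (suc y)) _ τ
  inPlane? l x y τ z⁻ = yes tt
  inPlane? l x y τ z⁺ = yes tt

  justified? : ∀ l x y e → Dec (Justified l x y e)
  justified? l x y seed                  = yes tt
  justified? l x y (τ from d₁ , d₂ , d₃) =
    (¬? (d₁ ≟ᵈ d₂) ×-dec ¬? (d₁ ≟ᵈ d₃) ×-dec ¬? (d₂ ≟ᵈ d₃)) ×-dec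
    inPlane? l x y τ d₁ ×-dec inPlane? l x y τ d₂ ×-dec inPlane? l x y τ d₃

  planar? : ∀ l → Dec (Planar l)
  planar? l = everywhere? λ x y → justified? l x y (entry l x y)

  stackable? : ∀ lo hi → Dec (Stackable lo hi)
  stackable? lo hi = everywhere? λ x y →
    (needs? z⁻ (entry hi x y) →-dec precedes? _ (time lo x y) _ (time hi x y)) ×-dec
    (needs? z⁺ (entry lo x y) →-dec precedes? _ (time hi x y) _ (time lo x y))

  floor? : ∀ l → Dec (Floor l)
  floor? l = everywhere? λ x y → ¬? (needs? z⁻ (entry l x y))

  roof? : ∀ l → Dec (Roof l)
  roof? l = everywhere? λ x y → ¬? (needs? z⁺ (entry l x y))

  seedCount : L → ℕ
  seedCount l = length (filter (λ (x , y) → seed? (entry l (toℕ x) (toℕ y))) (plane a b))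

  module _ {c : ℕ} (S : Stack c) where

    open Stack S
    open Grid a b c

    rise : ℕ → ℕ
    rise zero    = 0
    rise (suc z) = gap (layer (suc z)) + rise z

    gapsAbove : ℕ → ℕ → ℕ
    gapsAbove z zero    = 0
    gapsAbove z (suc n) = gap (layer (suc z)) + gapsAbove (suc z) n

    fall : ℕ → ℕ
    fall z = gapsAbove z (c ∸ suc z)

    fall-step : ∀ {z} → suc z < c → fall z ≡ gap (layer (suc z)) + fall (suc z)
    fall-step {z} lt = cong (gapsAbove z) (+-∸-assoc 1 lt)

    clock : ℕ → ℕ × ℕ
    clock z = rise z , fall z

    entryAt : Pos → Entry
    entryAt (x , y , z) = entry (layer z) x y

    rankAt : Pos → Rank
    rankAt (x , y , z) = rank (time (layer z) x y) (clock z)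

    reach : ∀ {x y z τ ds} d → InBox (x , y , z) → entry (layer z) x y ≡ (τ from ds) →
            Needs d (τ from ds) → InPlane (layer z) x y τ d →
            Reaches (λ q → rankAt q ≺ rank τ (clock z)) d (x , y , z)
    reach {suc x} {y} {z} x⁻ (x<a , y<b , z<c) _ _ h =
      (x , y , z) , (refl , refl , refl) , (<⇒≤ x<a , y<b , z<c) , precedes-sound _ _ _ _ h (clock z)
    reach {x} {y} {z} x⁺ (_ , y<b , z<c) _ _ (sx<a , h) =
      (suc x , y , z) , (refl , refl , refl) , (sx<a , y<b , z<c) , precedes-sound _ _ _ _ h (clock z)
    reach {x} {suc y} {z} y⁻ (x<a , y<b , z<c) _ _ h =
      (x , y , z) , (refl , refl , refl) , (x<a , <⇒≤ y<b , z<c) , precedes-sound _ _ _ _ h (clock z)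
    reach {x} {y} {z} y⁺ (x<a , _ , z<c) _ _ (sy<b , h) =
      (x , suc y , z) , (refl , refl , refl) , (x<a , sy<b , z<c) , precedes-sound _ _ _ _ h (clock z)
    reach {x} {y} {zero} z⁻ (x<a , y<b , _) eq needs _ =
      ⊥-elim (floor x<a y<b (subst (Needs z⁻) (sym eq) needs))
    reach {x} {y} {suc z} z⁻ (x<a , y<b , z<c) eq needs _ =
      (x , y , z) , (refl , refl , refl) , (x<a , y<b , <⇒≤ z<c) ,
      subst₂ (λ ω τ → rank (time (layer z) x y) ω ≺ rank τ (clock (suc z)))
        (cong (rise z ,_) (sym (fall-step z<c))) (cong timeOf eq)
        (precedes-sound _ _ _ _ (proj₁ (stacked z z<c x<a y<b) (subst (Needs z⁻) (sym eq) needs))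
                        (rise z , fall (suc z)))
    reach {x} {y} {z} z⁺ (x<a , y<b , z<c) eq needs _ with m≤n⇒m<n∨m≡n z<c
    ... | inj₂ top = ⊥-elim (roof z top x<a y<b (subst (Needs z⁺) (sym eq) needs))
    ... | inj₁ sz<c =
      (x , y , suc z) , (refl , refl , refl) , (x<a , y<b , sz<c) ,
      subst₂ (λ ω τ → rank (time (layer (suc z)) x y) (clock (suc z)) ≺ rank τ ω)
        (cong (rise z ,_) (sym (fall-step sz<c))) (cong timeOf eq)
        (precedes-sound _ _ _ _ (proj₂ (stacked z sz<c x<a y<b) (subst (Needs z⁺) (sym eq) needs))
                        (rise z , fall (suc z)))

    justified : ∀ {p} → InBox p → entryAt p ≡ seed ⊎ ThreeMoves (λ q → rankAt q ≺ rankAt p) p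
    justified {x , y , z} p∈box@(x<a , y<b , _) with entry (layer z) x y in eq | planar z x<a y<b
    ... | seed | _ = inj₁ refl
    ... | τ from d₁ , d₂ , d₃ | distinct , s₁ , s₂ , s₃ =
      inj₂ (d₁ , d₂ , d₃ , distinct , reach d₁ p∈box eq (inj₁ refl) s₁ ,
            reach d₂ p∈box eq (inj₂ (inj₁ refl)) s₂ , reach d₃ p∈box eq (inj₂ (inj₂ refl)) s₃)

    seeds : List (Vertex a b c)
    seeds = filter (seed? ∘ entryAt ∘ pos) vertices

    seeds-percolate : Percolates (_∈ seeds)
    seeds-percolate = percolates-by-rank (_∈ seeds) ≺-wellFounded (rankAt ∘ pos) ranked
      where
      ranked : ∀ v → v ∈ seeds ⊎ ThreeNbrs (λ u → rankAt (pos u) ≺ rankAt (pos v)) v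
      ranked v = Sum.map (∈-filter⁺ (seed? ∘ entryAt ∘ pos) (∈-vertices v)) (threeNbrs-from-moves v)
                         (justified (pos-inBox v))

    length-seeds : length seeds ≡ sum (tabulate {n = c} (seedCount ∘ layer ∘ toℕ))
    length-seeds = trans (length-filter-cartesianProductWith (seed? ∘ entryAt ∘ pos) inLayer (allFin c) (plane a b))
                         (cong sum (map-tabulate {n = c} id (seedCount ∘ layer ∘ toℕ)))

    perfect : 3 * sum (tabulate {n = c} (seedCount ∘ layer ∘ toℕ)) ≡ a * b + a * c + b * c → Perfect a b c
    perfect count = seeds , Unique.filter⁺ _ vertices-unique , trans (cong (3 *_) length-seeds) count , seeds-percolate

data Layer : Set where
  short₀ short₁ short₂ short₃ base₀ base₁ base₂ period₀ period₁ period₂ cap₀ cap₁ : Layer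

every-layer? : ∀ {P : Layer → Set} → (∀ l → Dec (P l)) → Dec (∀ l → P l)
every-layer? {P} P? =
  map′ pick (λ h → h short₀ , h short₁ , h short₂ , h short₃ , h base₀ , h base₁ , h base₂ ,
                   h period₀ , h period₁ , h period₂ , h cap₀ , h cap₁)
    (P? short₀ ×-dec P? short₁ ×-dec P? short₂ ×-dec P? short₃ ×-dec P? base₀ ×-dec P? base₁ ×-dec
     P? base₂ ×-dec P? period₀ ×-dec P? period₁ ×-dec P? period₂ ×-dec P? cap₀ ×-dec P? cap₁)
  where
  pick : P short₀ × P short₁ × P short₂ × P short₃ × P base₀ × P base₁ × P base₂ ×
         P period₀ × P period₁ × P period₂ × P cap₀ × P cap₁ → ∀ l → P l
  pick (p , _) short₀ = p
  pick (_ , p , _) short₁ = p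
  pick (_ , _ , p , _) short₂ = p
  pick (_ , _ , _ , p , _) short₃ = p
  pick (_ , _ , _ , _ , p , _) base₀ = p
  pick (_ , _ , _ , _ , _ , p , _) base₁ = p
  pick (_ , _ , _ , _ , _ , _ , p , _) base₂ = p
  pick (_ , _ , _ , _ , _ , _ , _ , p , _) period₀ = p
  pick (_ , _ , _ , _ , _ , _ , _ , _ , p , _) period₁ = p
  pick (_ , _ , _ , _ , _ , _ , _ , _ , _ , p , _) period₂ = p
  pick (_ , _ , _ , _ , _ , _ , _ , _ , _ , _ , p , _) cap₀ = p
  pick (_ , _ , _ , _ , _ , _ , _ , _ , _ , _ , _ , p) cap₁ = p

consecutive : Layer → Layer → Bool
consecutive short₀  short₁  = true
consecutive short₁  short₂  = true
consecutive short₂  short₃  = true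
consecutive base₀   base₁   = true
consecutive base₁   base₂   = true
consecutive base₂   period₀ = true
consecutive period₀ period₁ = true
consecutive period₁ period₂ = true
consecutive period₂ period₀ = true
consecutive period₁ cap₀    = true
consecutive cap₀    cap₁    = true
consecutive _       _       = false

towerGap : ℕ → Layer → ℕ
towerGap M period₀ = M
towerGap M cap₁    = M
towerGap M _       = 0

upper : ℕ → ℕ → Layer
upper zero    0                   = period₀
upper zero    1                   = period₁
upper zero    2                   = cap₀
upper zero    (suc (suc (suc _))) = cap₁
upper (suc j) 0                   = period₀
upper (suc j) 1                   = period₁
upper (suc j) 2                   = period₂
upper (suc j) (suc (suc (suc z))) = upper j z

layer : ℕ → ℕ → Layer
layer zero    0                   = short₀
layer zero    1                   = short₁
layer zero    2                   = short₂
layer zero    (suc (suc (suc _))) = short₃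
layer (suc k) 0                   = base₀
layer (suc k) 1                   = base₁
layer (suc k) 2                   = base₂
layer (suc k) (suc (suc (suc z))) = upper k z

upper-consecutive : ∀ j z → suc z < 4 + j * 3 → T (consecutive (upper j z) (upper j (suc z)))
upper-consecutive zero          0                   _ = tt
upper-consecutive zero          1                   _ = tt
upper-consecutive zero          2                   _ = tt
upper-consecutive zero          (suc (suc (suc z))) (s≤s (s≤s (s≤s (s≤s ()))))
upper-consecutive (suc j)       0                   _ = tt
upper-consecutive (suc j)       1                   _ = tt
upper-consecutive (suc zero)    2                   _ = tt
upper-consecutive (suc (suc j)) 2                   _ = tt
upper-consecutive (suc j)       (suc (suc (suc z))) (s≤s (s≤s (s≤s lt))) = upper-consecutive j z lt

layer-consecutive : ∀ k z → suc z < 4 + k * 3 → T (consecutive (layer k z) (layer k (suc z)))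
layer-consecutive zero          0                   _ = tt
layer-consecutive zero          1                   _ = tt
layer-consecutive zero          2                   _ = tt
layer-consecutive zero          (suc (suc (suc z))) (s≤s (s≤s (s≤s (s≤s ()))))
layer-consecutive (suc k)       0                   _ = tt
layer-consecutive (suc k)       1                   _ = tt
layer-consecutive (suc zero)    2                   _ = tt
layer-consecutive (suc (suc k)) 2                   _ = tt
layer-consecutive (suc k)       (suc (suc (suc z))) (s≤s (s≤s (s≤s lt))) = upper-consecutive k z lt

upper-top : ∀ j → upper j (3 + j * 3) ≡ cap₁
upper-top zero    = refl
upper-top (suc j) = upper-top j

module Tower (a b M : ℕ) (entry : Layer → ℕ → ℕ → Entry) where

  open Layered a b entry (towerGap M) public

  Certified : Set
  Certified = (∀ l → Planar l) × (∀ lo hi → T (consecutive lo hi) → Stackable lo hi) ×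
              Floor short₀ × Floor base₀ × Roof short₃ × Roof cap₁

  certified? : Dec Certified
  certified? =
    every-layer? planar? ×-dec
    every-layer? (λ lo → every-layer? λ hi → T? (consecutive lo hi) →-dec stackable? lo hi) ×-dec
    floor? short₀ ×-dec floor? base₀ ×-dec roof? short₃ ×-dec roof? cap₁

  tower : Certified → ∀ k → Stack (4 + k * 3)
  tower (planar , stackable , floor-short , floor-base , roof-short , roof-cap) k = record
    { layer   = layer k
    ; planar  = λ z → planar (layer k z)
    ; stacked = λ z lt → stackable _ _ (layer-consecutive k z lt)
    ; floor   = floor k
    ; roof    = λ { z refl → roof k }
    }
    where
    floor : ∀ k → Floor (layer k 0)
    floor zero    = floor-short
    floor (suc k) = floor-base

    roof : ∀ k → Roof (layer k (3 + k * 3))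
    roof zero    = roof-short
    roof (suc j) = subst Roof (sym (upper-top j)) roof-cap

entry44 : Layer → ℕ → ℕ → Entry
entry44 short₀ 0 0 = rising 11 from x⁺ , y⁺ , z⁺
entry44 short₀ 0 1 = rising 10 from x⁺ , y⁺ , z⁺
entry44 short₀ 0 3 = rising 10 from x⁺ , y⁻ , z⁺
entry44 short₀ 1 1 = rising 9 from y⁻ , y⁺ , z⁺
entry44 short₀ 1 2 = rising 8 from x⁻ , x⁺ , z⁺
entry44 short₀ 1 3 = rising 9 from x⁺ , y⁻ , z⁺
entry44 short₀ 2 0 = rising 11 from x⁻ , y⁺ , z⁺
entry44 short₀ 2 1 = rising 10 from x⁻ , y⁺ , z⁺
entry44 short₀ 2 2 = rising 7 from x⁺ , y⁺ , z⁺
entry44 short₀ 3 0 = rising 12 from x⁻ , y⁺ , z⁺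
entry44 short₀ 3 1 = rising 11 from x⁻ , y⁺ , z⁺
entry44 short₀ 3 3 = rising 1 from x⁻ , y⁻ , z⁺
entry44 short₁ 0 1 = rising 1 from x⁺ , y⁻ , z⁺
entry44 short₁ 0 2 = rising 2 from y⁻ , z⁻ , z⁺
entry44 short₁ 0 3 = rising 9 from x⁺ , y⁻ , z⁺
entry44 short₁ 1 0 = rising 1 from x⁻ , y⁺ , z⁻
entry44 short₁ 1 2 = rising 5 from x⁻ , y⁻ , z⁺
entry44 short₁ 1 3 = rising 8 from x⁺ , y⁻ , z⁺
entry44 short₁ 2 0 = rising 2 from x⁻ , x⁺ , z⁺
entry44 short₁ 2 1 = rising 5 from x⁻ , y⁻ , z⁺
entry44 short₁ 2 2 = rising 6 from x⁻ , y⁻ , z⁺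
entry44 short₁ 2 3 = rising 7 from x⁺ , y⁻ , z⁻
entry44 short₁ 3 1 = rising 8 from x⁻ , y⁻ , y⁺
entry44 short₁ 3 2 = rising 7 from x⁻ , y⁺ , z⁻
entry44 short₂ 0 0 = rising 3 from x⁺ , y⁺ , z⁻
entry44 short₂ 0 2 = rising 1 from y⁻ , y⁺ , z⁺
entry44 short₂ 1 0 = rising 2 from x⁺ , z⁻ , z⁺
entry44 short₂ 1 1 = rising 3 from x⁻ , y⁻ , z⁻
entry44 short₂ 1 2 = rising 4 from x⁻ , x⁺ , y⁻
entry44 short₂ 1 3 = rising 5 from x⁻ , y⁻ , z⁺
entry44 short₂ 2 1 = rising 4 from x⁻ , y⁻ , y⁺
entry44 short₂ 2 3 = rising 8 from x⁻ , y⁻ , z⁻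
entry44 short₂ 3 0 = rising 10 from x⁻ , y⁺ , z⁻
entry44 short₂ 3 1 = rising 9 from x⁻ , y⁺ , z⁻
entry44 short₂ 3 2 = rising 8 from x⁻ , z⁻ , z⁺
entry44 short₂ 3 3 = rising 9 from x⁻ , y⁻ , z⁻
entry44 short₃ 0 0 = rising 8 from x⁺ , y⁺ , z⁻
entry44 short₃ 0 1 = rising 7 from x⁺ , y⁺ , z⁻
entry44 short₃ 0 3 = rising 1 from x⁺ , y⁻ , z⁻
entry44 short₃ 1 1 = rising 6 from y⁻ , y⁺ , z⁻
entry44 short₃ 1 2 = rising 5 from x⁻ , y⁺ , z⁻
entry44 short₃ 2 0 = rising 8 from x⁻ , y⁺ , z⁻
entry44 short₃ 2 1 = rising 7 from x⁻ , y⁺ , z⁻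
entry44 short₃ 2 2 = rising 6 from x⁻ , x⁺ , z⁻
entry44 short₃ 2 3 = rising 9 from x⁻ , y⁻ , z⁻
entry44 short₃ 3 0 = rising 11 from x⁻ , y⁺ , z⁻
entry44 short₃ 3 1 = rising 10 from x⁻ , y⁺ , z⁻
entry44 short₃ 3 3 = rising 10 from x⁻ , y⁻ , z⁻
entry44 base₀ 0 0 = rising 11 from x⁺ , y⁺ , z⁺
entry44 base₀ 0 1 = rising 10 from x⁺ , y⁺ , z⁺
entry44 base₀ 0 3 = rising 10 from x⁺ , y⁻ , z⁺
entry44 base₀ 1 1 = rising 9 from y⁻ , y⁺ , z⁺
entry44 base₀ 1 2 = rising 8 from x⁻ , x⁺ , z⁺
entry44 base₀ 1 3 = rising 9 from x⁺ , y⁻ , z⁺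
entry44 base₀ 2 0 = rising 11 from x⁻ , y⁺ , z⁺
entry44 base₀ 2 1 = rising 10 from x⁻ , y⁺ , z⁺
entry44 base₀ 2 2 = rising 7 from x⁺ , y⁺ , z⁺
entry44 base₀ 3 0 = rising 12 from x⁻ , y⁺ , z⁺
entry44 base₀ 3 1 = rising 11 from x⁻ , y⁺ , z⁺
entry44 base₀ 3 3 = rising 1 from x⁻ , y⁻ , z⁺
entry44 base₁ 0 1 = rising 1 from x⁺ , y⁻ , z⁺
entry44 base₁ 0 2 = rising 4 from y⁻ , z⁻ , z⁺
entry44 base₁ 0 3 = rising 9 from x⁺ , y⁻ , z⁺
entry44 base₁ 1 0 = rising 1 from x⁻ , y⁺ , z⁻
entry44 base₁ 1 2 = rising 5 from x⁻ , y⁻ , z⁺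
entry44 base₁ 1 3 = rising 8 from x⁺ , y⁻ , z⁺
entry44 base₁ 2 0 = rising 2 from x⁻ , x⁺ , z⁺
entry44 base₁ 2 1 = rising 3 from x⁻ , y⁻ , z⁺
entry44 base₁ 2 2 = rising 6 from x⁻ , y⁻ , z⁺
entry44 base₁ 2 3 = rising 7 from x⁺ , y⁻ , z⁻
entry44 base₁ 3 1 = rising 8 from x⁻ , y⁻ , y⁺
entry44 base₁ 3 2 = rising 7 from x⁻ , y⁺ , z⁻
entry44 base₂ 0 0 = rising 3 from x⁺ , y⁺ , z⁻
entry44 base₂ 0 2 = rising 3 from x⁺ , y⁻ , y⁺
entry44 base₂ 1 0 = rising 2 from x⁺ , y⁺ , z⁻
entry44 base₂ 1 1 = rising 1 from x⁻ , z⁻ , z⁺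
entry44 base₂ 1 2 = rising 2 from x⁺ , y⁻ , z⁺
entry44 base₂ 1 3 = rising 3 from x⁻ , y⁻ , z⁺
entry44 base₂ 2 1 = rising 2 from x⁻ , y⁻ , y⁺
entry44 base₂ 2 3 = rising 8 from x⁻ , y⁻ , z⁻
entry44 base₂ 3 0 = rising 10 from x⁻ , y⁺ , z⁻
entry44 base₂ 3 1 = rising 9 from x⁻ , y⁺ , z⁻
entry44 base₂ 3 2 = rising 8 from x⁻ , z⁻ , z⁺
entry44 base₂ 3 3 = rising 9 from x⁻ , y⁻ , z⁻
entry44 period₀ 0 0 = rising 8 from x⁺ , z⁻ , z⁺
entry44 period₀ 0 1 = rising 9 from x⁺ , y⁻ , z⁻
entry44 period₀ 0 2 = rising 10 from x⁺ , y⁻ , z⁻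
entry44 period₀ 0 3 = rising 11 from x⁺ , y⁻ , z⁻
entry44 period₀ 1 0 = rising 7 from x⁺ , y⁺ , z⁻
entry44 period₀ 1 2 = fixed 1 from y⁻ , y⁺ , z⁺
entry44 period₀ 2 0 = rising 6 from x⁺ , y⁺ , z⁻
entry44 period₀ 2 1 = rising 3 from x⁻ , y⁺ , z⁻
entry44 period₀ 2 2 = rising 2 from x⁻ , x⁺ , z⁻
entry44 period₀ 2 3 = rising 3 from x⁻ , y⁻ , z⁻
entry44 period₀ 3 0 = rising 5 from y⁺ , z⁻ , z⁺
entry44 period₀ 3 1 = rising 4 from x⁻ , y⁺ , z⁻
entry44 period₀ 3 3 = rising 4 from x⁻ , y⁻ , z⁻
entry44 period₁ 0 1 = rising 10 from x⁺ , y⁻ , z⁻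
entry44 period₁ 0 2 = rising 11 from x⁺ , y⁻ , z⁻
entry44 period₁ 0 3 = rising 12 from y⁻ , z⁻ , z⁺
entry44 period₁ 1 0 = rising 8 from x⁻ , x⁺ , z⁻
entry44 period₁ 1 1 = rising 9 from y⁻ , y⁺ , z⁻
entry44 period₁ 1 3 = rising 13 from x⁻ , y⁻ , z⁻
entry44 period₁ 2 0 = rising 7 from x⁺ , z⁻ , z⁺
entry44 period₁ 2 1 = rising 10 from x⁻ , y⁻ , z⁻
entry44 period₁ 2 2 = rising 11 from x⁻ , y⁻ , z⁻
entry44 period₁ 2 3 = rising 14 from x⁻ , y⁻ , z⁻
entry44 period₁ 3 1 = rising 11 from x⁻ , y⁻ , z⁻
entry44 period₁ 3 2 = rising 12 from x⁻ , y⁻ , z⁻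
entry44 period₁ 3 3 = rising 15 from x⁻ , y⁻ , z⁻
entry44 period₂ 0 0 = rising 18 from x⁺ , y⁺ , z⁻
entry44 period₂ 0 1 = rising 17 from x⁺ , y⁺ , z⁻
entry44 period₂ 0 2 = rising 16 from x⁺ , y⁺ , z⁻
entry44 period₂ 1 0 = rising 17 from x⁺ , y⁺ , z⁻
entry44 period₂ 1 1 = rising 16 from y⁺ , z⁻ , z⁺
entry44 period₂ 1 2 = rising 15 from y⁺ , z⁻ , z⁺
entry44 period₂ 1 3 = rising 14 from x⁻ , z⁻ , z⁺
entry44 period₂ 2 1 = rising 17 from x⁻ , y⁻ , z⁻
entry44 period₂ 2 2 = rising 18 from x⁻ , y⁻ , z⁻
entry44 period₂ 2 3 = rising 19 from x⁻ , y⁻ , z⁻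
entry44 period₂ 3 0 = rising 21 from x⁻ , y⁺ , z⁻
entry44 period₂ 3 1 = rising 20 from x⁻ , y⁺ , z⁻
entry44 period₂ 3 2 = rising 19 from x⁻ , z⁻ , z⁺
entry44 period₂ 3 3 = rising 20 from x⁻ , y⁻ , z⁻
entry44 cap₀ 0 0 = falling 2 from x⁺ , y⁺ , z⁻
entry44 cap₀ 0 1 = falling 1 from x⁺ , y⁺ , z⁻
entry44 cap₀ 0 2 = rising 12 from y⁺ , z⁻ , z⁺
entry44 cap₀ 1 0 = rising 9 from x⁺ , z⁻ , z⁺
entry44 cap₀ 1 1 = falling 0 from y⁻ , y⁺ , z⁻
entry44 cap₀ 1 2 = rising 15 from x⁻ , y⁺ , z⁻
entry44 cap₀ 1 3 = rising 14 from x⁻ , z⁻ , z⁺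
entry44 cap₀ 2 1 = falling 1 from x⁻ , y⁻ , z⁻
entry44 cap₀ 2 2 = falling 2 from x⁻ , y⁻ , z⁻
entry44 cap₀ 2 3 = falling 3 from x⁻ , y⁻ , z⁻
entry44 cap₀ 3 0 = falling 5 from x⁻ , y⁺ , z⁻
entry44 cap₀ 3 1 = falling 4 from x⁻ , y⁺ , z⁻
entry44 cap₀ 3 2 = falling 3 from x⁻ , z⁻ , z⁺
entry44 cap₀ 3 3 = falling 4 from x⁻ , y⁻ , z⁻
entry44 cap₁ 0 0 = falling 20 from x⁺ , y⁺ , z⁻
entry44 cap₁ 0 1 = falling 19 from x⁺ , y⁺ , z⁻
entry44 cap₁ 0 3 = rising 1 from x⁺ , y⁻ , z⁻
entry44 cap₁ 1 1 = falling 18 from y⁻ , y⁺ , z⁻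
entry44 cap₁ 1 2 = falling 0 from x⁻ , y⁺ , z⁻
entry44 cap₁ 2 0 = falling 22 from x⁻ , y⁺ , z⁻
entry44 cap₁ 2 1 = falling 21 from x⁻ , y⁺ , z⁻
entry44 cap₁ 2 2 = falling 20 from x⁻ , x⁺ , z⁻
entry44 cap₁ 2 3 = falling 21 from x⁻ , y⁻ , z⁻
entry44 cap₁ 3 0 = falling 23 from x⁻ , y⁺ , z⁻
entry44 cap₁ 3 1 = falling 22 from x⁻ , y⁺ , z⁻
entry44 cap₁ 3 3 = falling 22 from x⁻ , y⁻ , z⁻
entry44 _ _ _ = seed

entry47 : Layer → ℕ → ℕ → Entry
entry47 short₀ 0 1 = rising 1 from y⁻ , y⁺ , z⁺
entry47 short₀ 0 3 = rising 13 from x⁺ , y⁻ , z⁺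
entry47 short₀ 0 4 = rising 16 from x⁺ , y⁻ , z⁺
entry47 short₀ 0 5 = rising 19 from x⁺ , y⁻ , z⁺
entry47 short₀ 0 6 = rising 20 from x⁺ , y⁻ , z⁺
entry47 short₀ 1 0 = rising 1 from x⁻ , x⁺ , z⁺
entry47 short₀ 1 1 = rising 2 from x⁻ , y⁻ , z⁺
entry47 short₀ 1 2 = rising 3 from x⁻ , y⁻ , z⁺
entry47 short₀ 1 3 = rising 12 from x⁺ , y⁻ , z⁺
entry47 short₀ 1 4 = rising 15 from x⁺ , y⁻ , z⁺
entry47 short₀ 1 5 = rising 18 from x⁺ , y⁻ , z⁺
entry47 short₀ 1 6 = rising 19 from x⁺ , y⁻ , z⁺
entry47 short₀ 2 1 = rising 3 from x⁻ , y⁻ , z⁺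
entry47 short₀ 2 2 = rising 4 from x⁻ , y⁻ , y⁺
entry47 short₀ 2 4 = rising 14 from x⁺ , y⁻ , z⁺
entry47 short₀ 2 5 = rising 17 from x⁺ , y⁻ , z⁺
entry47 short₀ 2 6 = rising 18 from x⁺ , y⁻ , z⁺
entry47 short₀ 3 0 = rising 15 from x⁻ , y⁺ , z⁺
entry47 short₀ 3 1 = rising 14 from x⁻ , y⁺ , z⁺
entry47 short₀ 3 2 = rising 13 from x⁻ , y⁺ , z⁺
entry47 short₀ 3 3 = rising 12 from x⁻ , y⁺ , z⁺
entry47 short₀ 3 5 = rising 16 from y⁻ , y⁺ , z⁺
entry47 short₁ 0 0 = rising 1 from x⁺ , y⁺ , z⁻
entry47 short₁ 0 2 = rising 1 from x⁺ , y⁻ , z⁻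
entry47 short₁ 0 3 = rising 12 from x⁺ , y⁻ , z⁺
entry47 short₁ 0 4 = rising 15 from x⁺ , y⁻ , z⁺
entry47 short₁ 0 5 = rising 18 from x⁺ , y⁻ , z⁺
entry47 short₁ 0 6 = rising 19 from x⁺ , y⁻ , z⁺
entry47 short₁ 1 1 = rising 1 from x⁻ , y⁻ , y⁺
entry47 short₁ 1 3 = rising 11 from x⁺ , y⁻ , z⁺
entry47 short₁ 1 4 = rising 14 from x⁺ , y⁻ , z⁺
entry47 short₁ 1 5 = rising 15 from x⁺ , y⁻ , z⁺
entry47 short₁ 1 6 = rising 16 from x⁺ , y⁻ , z⁺
entry47 short₁ 2 0 = rising 3 from x⁻ , y⁺ , z⁻
entry47 short₁ 2 1 = rising 2 from x⁻ , x⁺ , z⁺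
entry47 short₁ 2 2 = rising 5 from x⁻ , y⁻ , z⁻
entry47 short₁ 2 3 = rising 10 from y⁻ , z⁻ , z⁺
entry47 short₁ 2 4 = rising 13 from x⁺ , y⁻ , z⁺
entry47 short₁ 2 5 = rising 14 from y⁻ , y⁺ , z⁺
entry47 short₁ 3 0 = rising 4 from x⁻ , y⁺ , z⁺
entry47 short₁ 3 2 = rising 10 from x⁻ , y⁻ , z⁺
entry47 short₁ 3 3 = rising 11 from x⁻ , y⁻ , z⁺
entry47 short₁ 3 4 = rising 12 from y⁻ , z⁻ , z⁺
entry47 short₁ 3 5 = rising 15 from x⁻ , y⁻ , z⁺
entry47 short₁ 3 6 = rising 16 from x⁻ , y⁻ , z⁻
entry47 short₂ 0 0 = rising 8 from x⁺ , y⁺ , z⁻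
entry47 short₂ 0 1 = rising 7 from x⁺ , z⁻ , z⁺
entry47 short₂ 0 2 = rising 8 from x⁺ , y⁻ , z⁻
entry47 short₂ 0 3 = rising 9 from x⁺ , y⁻ , y⁺
entry47 short₂ 0 5 = rising 17 from x⁺ , y⁻ , z⁺
entry47 short₂ 0 6 = rising 18 from x⁺ , y⁻ , z⁺
entry47 short₂ 1 0 = rising 5 from x⁺ , z⁻ , z⁺
entry47 short₂ 1 1 = rising 6 from x⁺ , y⁻ , z⁻
entry47 short₂ 1 2 = rising 7 from y⁻ , y⁺ , z⁻
entry47 short₂ 1 4 = rising 11 from x⁻ , x⁺ , y⁻
entry47 short₂ 1 5 = rising 12 from x⁺ , y⁻ , y⁺
entry47 short₂ 2 0 = rising 4 from x⁺ , y⁺ , z⁻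
entry47 short₂ 2 2 = rising 8 from x⁻ , y⁻ , z⁻
entry47 short₂ 2 3 = rising 9 from x⁻ , y⁻ , z⁺
entry47 short₂ 2 4 = rising 10 from x⁺ , y⁻ , y⁺
entry47 short₂ 2 6 = rising 1 from x⁻ , y⁻ , z⁻
entry47 short₂ 3 1 = rising 1 from x⁻ , y⁻ , z⁻
entry47 short₂ 3 2 = rising 9 from x⁻ , y⁻ , z⁺
entry47 short₂ 3 3 = rising 10 from x⁻ , y⁻ , y⁺
entry47 short₂ 3 5 = rising 1 from x⁻ , y⁻ , z⁺
entry47 short₂ 3 6 = rising 17 from x⁻ , y⁻ , z⁻
entry47 short₃ 0 0 = rising 9 from x⁺ , y⁺ , z⁻
entry47 short₃ 0 2 = rising 11 from x⁺ , y⁻ , z⁻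
entry47 short₃ 0 3 = rising 12 from x⁺ , y⁻ , z⁻
entry47 short₃ 0 4 = rising 15 from x⁺ , y⁻ , z⁻
entry47 short₃ 0 5 = rising 16 from x⁺ , y⁻ , y⁺
entry47 short₃ 1 1 = rising 7 from x⁻ , y⁻ , z⁻
entry47 short₃ 1 2 = rising 10 from x⁺ , y⁻ , z⁻
entry47 short₃ 1 3 = rising 11 from x⁺ , y⁻ , z⁻
entry47 short₃ 1 4 = rising 14 from x⁺ , y⁻ , z⁻
entry47 short₃ 1 5 = rising 15 from x⁺ , y⁻ , z⁻
entry47 short₃ 1 6 = rising 16 from x⁻ , y⁻ , z⁻
entry47 short₃ 2 0 = rising 11 from x⁻ , y⁺ , z⁻
entry47 short₃ 2 1 = rising 10 from x⁻ , y⁺ , z⁻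
entry47 short₃ 2 2 = rising 9 from x⁺ , y⁺ , z⁻
entry47 short₃ 2 4 = rising 13 from x⁺ , y⁻ , z⁻
entry47 short₃ 2 5 = rising 14 from x⁺ , y⁻ , z⁻
entry47 short₃ 2 6 = rising 17 from x⁻ , y⁻ , z⁻
entry47 short₃ 3 0 = rising 12 from x⁻ , y⁺ , z⁻
entry47 short₃ 3 1 = rising 11 from x⁻ , y⁺ , z⁻
entry47 short₃ 3 3 = rising 11 from x⁻ , y⁻ , z⁻
entry47 short₃ 3 4 = rising 12 from y⁻ , y⁺ , z⁻
entry47 short₃ 3 6 = rising 18 from x⁻ , y⁻ , z⁻
entry47 base₀ 0 1 = rising 7 from x⁺ , y⁻ , y⁺
entry47 base₀ 0 3 = rising 13 from x⁺ , y⁻ , z⁺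
entry47 base₀ 0 4 = rising 18 from x⁺ , y⁻ , z⁺
entry47 base₀ 0 5 = rising 23 from y⁻ , y⁺ , z⁺
entry47 base₀ 1 0 = rising 5 from x⁻ , x⁺ , z⁺
entry47 base₀ 1 1 = rising 6 from x⁺ , y⁻ , z⁺
entry47 base₀ 1 2 = rising 7 from x⁻ , y⁻ , z⁺
entry47 base₀ 1 3 = rising 12 from x⁺ , y⁻ , z⁺
entry47 base₀ 1 4 = rising 13 from x⁺ , y⁻ , z⁺
entry47 base₀ 1 5 = rising 24 from x⁻ , y⁻ , z⁺
entry47 base₀ 1 6 = falling 3 from x⁻ , y⁻ , z⁺
entry47 base₀ 2 0 = rising 4 from x⁺ , y⁺ , z⁺
entry47 base₀ 2 2 = rising 8 from x⁻ , x⁺ , y⁻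
entry47 base₀ 2 3 = rising 11 from y⁻ , y⁺ , z⁺
entry47 base₀ 2 5 = rising 25 from x⁻ , y⁻ , z⁺
entry47 base₀ 2 6 = falling 4 from x⁻ , y⁻ , z⁺
entry47 base₀ 3 1 = rising 1 from x⁻ , y⁻ , y⁺
entry47 base₀ 3 3 = falling 2 from x⁻ , y⁻ , z⁺
entry47 base₀ 3 4 = falling 3 from x⁻ , y⁻ , z⁺
entry47 base₀ 3 5 = falling 4 from x⁻ , y⁻ , z⁺
entry47 base₀ 3 6 = falling 5 from x⁻ , y⁻ , z⁺
entry47 base₁ 0 0 = rising 9 from x⁺ , y⁺ , z⁻
entry47 base₁ 0 1 = rising 8 from x⁺ , y⁺ , z⁻
entry47 base₁ 0 2 = rising 1 from x⁺ , y⁺ , z⁻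
entry47 base₁ 0 4 = rising 17 from x⁺ , y⁻ , z⁺
entry47 base₁ 0 5 = rising 22 from x⁺ , y⁻ , z⁺
entry47 base₁ 0 6 = falling 1 from y⁻ , z⁻ , z⁺
entry47 base₁ 1 1 = rising 1 from y⁻ , y⁺ , z⁺
entry47 base₁ 1 3 = rising 1 from x⁻ , y⁻ , y⁺
entry47 base₁ 1 5 = rising 21 from x⁺ , y⁻ , z⁺
entry47 base₁ 1 6 = falling 2 from x⁻ , y⁻ , z⁺
entry47 base₁ 2 0 = rising 3 from x⁻ , y⁺ , z⁺
entry47 base₁ 2 1 = rising 2 from x⁻ , z⁻ , z⁺
entry47 base₁ 2 2 = rising 9 from x⁻ , y⁻ , z⁻
entry47 base₁ 2 3 = rising 10 from x⁻ , y⁻ , y⁺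
entry47 base₁ 2 4 = rising 1 from x⁻ , y⁺ , z⁻
entry47 base₁ 2 6 = falling 3 from x⁻ , y⁻ , z⁺
entry47 base₁ 3 0 = rising 4 from x⁻ , y⁺ , z⁻
entry47 base₁ 3 1 = rising 3 from x⁻ , z⁻ , z⁺
entry47 base₁ 3 2 = rising 10 from x⁻ , y⁻ , z⁻
entry47 base₁ 3 3 = falling 1 from x⁻ , y⁻ , z⁺
entry47 base₁ 3 4 = falling 2 from x⁻ , y⁻ , z⁺
entry47 base₁ 3 5 = falling 3 from x⁻ , y⁻ , z⁺
entry47 base₁ 3 6 = falling 4 from x⁻ , y⁻ , z⁺
entry47 base₂ 0 0 = rising 18 from x⁺ , y⁺ , z⁻
entry47 base₂ 0 1 = rising 17 from x⁺ , y⁺ , z⁻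
entry47 base₂ 0 2 = rising 16 from x⁺ , y⁺ , z⁻
entry47 base₂ 0 3 = rising 15 from x⁺ , z⁻ , z⁺
entry47 base₂ 0 4 = rising 16 from y⁻ , y⁺ , z⁺
entry47 base₂ 0 6 = falling 0 from x⁺ , y⁻ , z⁺
entry47 base₂ 1 0 = rising 1 from x⁺ , y⁺ , z⁻
entry47 base₂ 1 2 = rising 13 from x⁺ , y⁻ , z⁻
entry47 base₂ 1 3 = rising 14 from y⁻ , z⁻ , z⁺
entry47 base₂ 1 4 = rising 17 from x⁻ , y⁻ , z⁻
entry47 base₂ 1 5 = rising 20 from x⁻ , x⁺ , y⁻
entry47 base₂ 1 6 = rising 21 from x⁺ , y⁻ , z⁺
entry47 base₂ 2 1 = rising 1 from x⁻ , x⁺ , y⁻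
entry47 base₂ 2 2 = rising 12 from x⁺ , y⁻ , z⁻
entry47 base₂ 2 3 = rising 15 from x⁻ , y⁻ , z⁻
entry47 base₂ 2 4 = rising 18 from x⁻ , y⁻ , z⁻
entry47 base₂ 2 5 = rising 19 from y⁻ , y⁺ , z⁻
entry47 base₂ 3 0 = rising 5 from x⁻ , y⁺ , z⁻
entry47 base₂ 3 2 = rising 11 from y⁻ , z⁻ , z⁺
entry47 base₂ 3 3 = falling 0 from x⁻ , y⁻ , z⁺
entry47 base₂ 3 4 = falling 1 from x⁻ , y⁻ , z⁺
entry47 base₂ 3 5 = falling 2 from x⁻ , y⁻ , z⁺
entry47 base₂ 3 6 = falling 3 from x⁻ , y⁻ , z⁺
entry47 period₀ 0 0 = rising 14 from x⁺ , y⁺ , z⁻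
entry47 period₀ 0 1 = rising 9 from x⁺ , y⁺ , z⁻
entry47 period₀ 0 2 = rising 8 from x⁺ , y⁺ , z⁻
entry47 period₀ 0 3 = fixed 1 from x⁺ , y⁺ , z⁺
entry47 period₀ 0 5 = rising 3 from x⁺ , y⁻ , z⁻
entry47 period₀ 0 6 = falling 9 from x⁺ , y⁻ , z⁺
entry47 period₀ 1 0 = rising 13 from x⁺ , y⁺ , z⁻
entry47 period₀ 1 1 = rising 8 from y⁺ , z⁻ , z⁺
entry47 period₀ 1 2 = rising 7 from x⁺ , y⁺ , z⁻
entry47 period₀ 1 4 = rising 1 from x⁻ , y⁻ , z⁻
entry47 period₀ 1 5 = rising 2 from y⁻ , y⁺ , z⁻
entry47 period₀ 2 0 = rising 12 from x⁺ , y⁺ , z⁻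
entry47 period₀ 2 1 = rising 9 from x⁻ , y⁺ , z⁻
entry47 period₀ 2 2 = rising 6 from x⁺ , y⁺ , z⁻
entry47 period₀ 2 3 = rising 5 from x⁻ , y⁺ , z⁻
entry47 period₀ 2 4 = rising 4 from x⁻ , y⁺ , z⁻
entry47 period₀ 2 5 = rising 3 from x⁻ , z⁻ , z⁺
entry47 period₀ 2 6 = rising 4 from x⁻ , y⁻ , z⁻
entry47 period₀ 3 0 = rising 11 from y⁺ , z⁻ , z⁺
entry47 period₀ 3 1 = rising 10 from x⁻ , y⁺ , z⁻
entry47 period₀ 3 3 = falling 19 from x⁻ , y⁻ , z⁺
entry47 period₀ 3 4 = falling 20 from x⁻ , y⁻ , z⁺
entry47 period₀ 3 5 = falling 21 from x⁻ , y⁻ , z⁺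
entry47 period₀ 3 6 = falling 22 from x⁻ , y⁻ , z⁺
entry47 period₁ 0 0 = rising 15 from x⁺ , y⁺ , z⁻
entry47 period₁ 0 1 = rising 10 from x⁺ , y⁺ , z⁻
entry47 period₁ 0 2 = rising 9 from x⁺ , y⁺ , z⁻
entry47 period₁ 0 4 = rising 19 from x⁺ , y⁻ , z⁻
entry47 period₁ 0 5 = rising 20 from x⁺ , y⁻ , z⁻
entry47 period₁ 0 6 = falling 8 from x⁺ , y⁻ , z⁺
entry47 period₁ 1 0 = rising 14 from x⁺ , y⁺ , z⁻
entry47 period₁ 1 2 = rising 8 from y⁻ , z⁻ , z⁺
entry47 period₁ 1 3 = rising 9 from x⁻ , y⁻ , z⁻
entry47 period₁ 1 4 = rising 18 from x⁺ , y⁻ , z⁻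
entry47 period₁ 1 5 = rising 19 from x⁺ , y⁻ , z⁻
entry47 period₁ 1 6 = rising 20 from x⁺ , y⁻ , z⁻
entry47 period₁ 2 0 = rising 13 from x⁺ , z⁻ , z⁺
entry47 period₁ 2 1 = rising 14 from x⁻ , y⁻ , z⁻
entry47 period₁ 2 2 = rising 15 from x⁻ , y⁻ , z⁻
entry47 period₁ 2 3 = rising 16 from x⁻ , y⁻ , z⁻
entry47 period₁ 2 4 = rising 17 from y⁻ , y⁺ , z⁻
entry47 period₁ 2 6 = rising 5 from y⁻ , z⁻ , z⁺
entry47 period₁ 3 1 = rising 15 from x⁻ , y⁻ , z⁻
entry47 period₁ 3 2 = rising 16 from x⁻ , y⁻ , z⁻
entry47 period₁ 3 3 = falling 18 from x⁻ , y⁻ , z⁺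
entry47 period₁ 3 4 = falling 19 from x⁻ , y⁻ , z⁺
entry47 period₁ 3 5 = falling 20 from x⁻ , y⁻ , z⁺
entry47 period₁ 3 6 = falling 21 from x⁻ , y⁻ , z⁺
entry47 period₂ 0 0 = rising 30 from x⁺ , y⁺ , z⁻
entry47 period₂ 0 1 = rising 29 from x⁺ , y⁺ , z⁻
entry47 period₂ 0 2 = rising 12 from x⁺ , y⁺ , z⁻
entry47 period₂ 0 3 = rising 11 from x⁺ , z⁻ , z⁺
entry47 period₂ 0 4 = rising 20 from y⁻ , z⁻ , z⁺
entry47 period₂ 0 5 = rising 23 from x⁺ , y⁻ , z⁻
entry47 period₂ 0 6 = falling 0 from x⁺ , y⁻ , z⁺
entry47 period₂ 1 0 = rising 29 from x⁺ , y⁺ , z⁻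
entry47 period₂ 1 1 = rising 28 from x⁺ , y⁺ , z⁻
entry47 period₂ 1 3 = rising 10 from y⁻ , z⁻ , z⁺
entry47 period₂ 1 4 = rising 21 from x⁻ , y⁻ , z⁻
entry47 period₂ 1 5 = rising 22 from y⁻ , y⁺ , z⁻
entry47 period₂ 1 6 = rising 21 from x⁺ , z⁻ , z⁺
entry47 period₂ 2 1 = rising 27 from y⁻ , y⁺ , z⁻
entry47 period₂ 2 2 = rising 26 from x⁻ , y⁺ , z⁻
entry47 period₂ 2 3 = rising 25 from x⁻ , y⁺ , z⁻
entry47 period₂ 2 4 = rising 24 from x⁻ , y⁺ , z⁻
entry47 period₂ 2 5 = rising 23 from x⁻ , y⁺ , z⁻
entry47 period₂ 3 0 = rising 29 from x⁻ , y⁺ , z⁻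
entry47 period₂ 3 1 = rising 28 from x⁻ , y⁺ , z⁻
entry47 period₂ 3 2 = rising 27 from x⁻ , z⁻ , z⁺
entry47 period₂ 3 3 = falling 0 from x⁻ , y⁻ , z⁺
entry47 period₂ 3 4 = falling 1 from x⁻ , y⁻ , z⁺
entry47 period₂ 3 5 = falling 2 from x⁻ , y⁻ , z⁺
entry47 period₂ 3 6 = falling 3 from x⁻ , y⁻ , z⁺
entry47 cap₀ 0 0 = falling 3 from x⁺ , y⁺ , z⁻
entry47 cap₀ 0 1 = falling 2 from x⁺ , z⁻ , z⁺
entry47 cap₀ 0 2 = falling 3 from x⁺ , y⁻ , z⁻
entry47 cap₀ 0 3 = falling 4 from x⁺ , y⁻ , z⁻
entry47 cap₀ 0 4 = falling 5 from x⁺ , y⁻ , z⁻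
entry47 cap₀ 0 5 = falling 6 from x⁺ , y⁻ , z⁻
entry47 cap₀ 0 6 = falling 7 from x⁺ , y⁻ , z⁺
entry47 cap₀ 1 0 = falling 2 from x⁺ , y⁺ , z⁻
entry47 cap₀ 1 1 = falling 1 from x⁺ , y⁺ , z⁻
entry47 cap₀ 1 3 = rising 25 from x⁺ , y⁻ , z⁻
entry47 cap₀ 1 4 = falling 0 from x⁺ , y⁻ , z⁻
entry47 cap₀ 1 5 = falling 1 from x⁺ , y⁻ , z⁻
entry47 cap₀ 1 6 = falling 2 from x⁺ , y⁻ , z⁻
entry47 cap₀ 2 1 = falling 0 from y⁻ , y⁺ , z⁻
entry47 cap₀ 2 2 = rising 25 from x⁻ , y⁺ , z⁻
entry47 cap₀ 2 3 = rising 24 from y⁺ , z⁻ , z⁺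
entry47 cap₀ 2 4 = rising 23 from y⁺ , z⁻ , z⁺
entry47 cap₀ 2 5 = rising 1 from y⁺ , z⁻ , z⁺
entry47 cap₀ 3 0 = rising 1 from x⁻ , z⁻ , z⁺
entry47 cap₀ 3 1 = falling 1 from x⁻ , y⁻ , z⁻
entry47 cap₀ 3 2 = falling 2 from x⁻ , y⁻ , z⁻
entry47 cap₀ 3 3 = falling 17 from x⁻ , y⁻ , z⁺
entry47 cap₀ 3 4 = falling 18 from x⁻ , y⁻ , z⁺
entry47 cap₀ 3 5 = falling 19 from x⁻ , y⁻ , z⁺
entry47 cap₀ 3 6 = falling 20 from x⁻ , y⁻ , z⁺
entry47 cap₁ 0 0 = falling 37 from x⁺ , y⁺ , z⁻
entry47 cap₁ 0 2 = falling 31 from y⁻ , y⁺ , z⁻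
entry47 cap₁ 0 3 = falling 30 from x⁺ , y⁺ , z⁻
entry47 cap₁ 0 4 = falling 29 from x⁺ , y⁺ , z⁻
entry47 cap₁ 0 5 = falling 28 from x⁺ , y⁺ , z⁻
entry47 cap₁ 1 0 = falling 36 from x⁺ , y⁺ , z⁻
entry47 cap₁ 1 1 = falling 33 from x⁻ , y⁺ , z⁻
entry47 cap₁ 1 2 = falling 32 from x⁻ , y⁺ , z⁻
entry47 cap₁ 1 3 = falling 27 from x⁺ , y⁺ , z⁻
entry47 cap₁ 1 4 = falling 26 from x⁺ , y⁺ , z⁻
entry47 cap₁ 1 5 = falling 25 from x⁺ , y⁺ , z⁻
entry47 cap₁ 1 6 = falling 24 from x⁻ , x⁺ , z⁻
entry47 cap₁ 2 0 = falling 35 from x⁺ , y⁺ , z⁻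
entry47 cap₁ 2 1 = falling 34 from x⁻ , y⁺ , z⁻
entry47 cap₁ 2 2 = falling 33 from x⁻ , y⁺ , z⁻
entry47 cap₁ 2 4 = rising 1 from x⁺ , y⁻ , y⁺
entry47 cap₁ 2 6 = rising 1 from x⁺ , y⁻ , z⁻
entry47 cap₁ 3 1 = falling 35 from x⁻ , y⁻ , z⁻
entry47 cap₁ 3 2 = falling 36 from x⁻ , y⁻ , z⁻
entry47 cap₁ 3 3 = falling 37 from x⁻ , y⁻ , y⁺
entry47 cap₁ 3 5 = rising 1 from x⁻ , y⁻ , y⁺
entry47 _ _ _ = seed

module Tower44 = Tower 4 4 17 entry44

perfect44 : ∀ k → Perfect 4 4 (4 + k * 3)
perfect44 k = Tower44.perfect (Tower44.tower (from-yes Tower44.certified?) k) (count k)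
  where
  upper-seeds : ∀ j → sum (tabulate {n = 4 + j * 3} (Tower44.seedCount ∘ upper j ∘ toℕ)) ≡ 12 + j * 8
  upper-seeds zero    = refl
  upper-seeds (suc j) = cong (8 +_) (upper-seeds j)

  arithmetic : ∀ j → 3 * (12 + (12 + j * 8)) ≡ 4 * 4 + 4 * (4 + suc j * 3) + 4 * (4 + suc j * 3)
  arithmetic = solve-∀

  count : ∀ k → 3 * sum (tabulate {n = 4 + k * 3} (Tower44.seedCount ∘ layer k ∘ toℕ)) ≡
                4 * 4 + 4 * (4 + k * 3) + 4 * (4 + k * 3)
  count zero    = refl
  count (suc j) = trans (cong (λ n → 3 * (12 + n)) (upper-seeds j)) (arithmetic j)

module Tower47 = Tower 4 7 21 entry47

perfect47 : ∀ k → Perfect 4 7 (4 + k * 3)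
perfect47 k = Tower47.perfect (Tower47.tower (from-yes Tower47.certified?) k) (count k)
  where
  upper-seeds : ∀ j → sum (tabulate {n = 4 + j * 3} (Tower47.seedCount ∘ upper j ∘ toℕ)) ≡ 18 + j * 11
  upper-seeds zero    = refl
  upper-seeds (suc j) = cong (11 +_) (upper-seeds j)

  arithmetic : ∀ j → 3 * (17 + (18 + j * 11)) ≡ 4 * 7 + 4 * (4 + suc j * 3) + 7 * (4 + suc j * 3)
  arithmetic = solve-∀

  count : ∀ k → 3 * sum (tabulate {n = 4 + k * 3} (Tower47.seedCount ∘ layer k ∘ toℕ)) ≡
                4 * 7 + 4 * (4 + k * 3) + 7 * (4 + k * 3)
  count zero    = refl
  count (suc j) = trans (cong (λ n → 3 * (17 + n)) (upper-seeds j)) (arithmetic j)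

tower-height : ∀ c → c ≥ 4 → c % 3 ≡ 1 → ∃[ k ] c ≡ 4 + k * 3
tower-height c c≥4 c%3≡1 with c / 3 | trans (m≡m%n+[m/n]*n c 3) (cong (_+ c / 3 * 3) c%3≡1)
tower-height _ (s≤s ()) _ | zero  | refl
tower-height _ _        _ | suc k | c≡4+k*3 = k , c≡4+k*3

perfect-of-towers : ∀ {a b} → (∀ k → Perfect a b (4 + k * 3)) → ∀ c → c ≥ 4 → c % 3 ≡ 1 → Perfect a b c
perfect-of-towers perfect c c≥4 c%3≡1 with tower-height c c≥4 c%3≡1
... | k , refl = perfect k

lemma3p4 : ((c : ℕ) → c ≥ 4 → c % 3 ≡ 1 → Perfect 4 4 c)
         × ((c : ℕ) → c ≥ 4 → c % 3 ≡ 1 → Perfect 4 7 c)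
lemma3p4 = perfect-of-towers perfect44 , perfect-of-towers perfect47
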